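{- Let $Q^+(7,2)$ be a non-degenerate hyperbolic quadric of ${\rm PG}(7,2)$, fix a generator $\Pi$ of it, and let $\mathcal G_3$ be the graph whose vertices are the points of $Q^+(7,2)\setminus\Pi$, two distinct vertices $P_1,P_2$ being adjacent iff either $\langle P_1,P_2\rangle$ is secant to $Q^+(7,2)$, or $\langle P_1,P_2\rangle$ is contained in $Q^+(7,2)$ and meets $\Pi$ in a point. Let $Q^-(3,2)$ be an elliptic quadric contained in $Q^+(7,2)$ (the intersection of $Q^+(7,2)$ with a solid) which does not meet $\Pi$. Then the points of $Q^-(3,2)$ form a maximal clique of $\mathcal G_3$ of size $5$.
   Context: A generator of $Q^+(7,2)$ is a solid contained in the quadric. A clique is maximal if it is not properly contained in another clique. -}

module Defs where

open import Data.Bool using (Bool; true; false; _∧_; _∨_; _xor_; not; T)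
open import Data.Vec using (Vec; []; _∷_; zipWith; replicate)
open import Data.Nat using (ℕ)
open import Data.List using (List; []; _∷_; length; filterᵇ; concatMap)
open import Data.Product using (_×_)
open import Data.Sum using (_⊎_)
open import Relation.Binary.PropositionalEquality using (_≡_; _≢_)
open import Relation.Nullary using (¬_)

-- Vectors of GF(2)^8 (GF(2) = Bool with xor as addition, ∧ as multiplication).
-- Points of PG(7,2) = nonzero vectors (over GF(2) each point has exactly one
-- nonzero representative).
V : Set
V = Vec Bool 8

_⊕_ : V → V → V
u ⊕ v = zipWith _xor_ u v

zeroV : V
zeroV = replicate 8 false

nonzero : ∀ {n} → Vec Bool n → Bool
nonzero [] = false
nonzero (x ∷ xs) = x ∨ nonzero xs

allVecs : (n : ℕ) → List (Vec Bool n)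
allVecs ℕ.zero = [] ∷ []
allVecs (ℕ.suc n) = concatMap (λ v → (false ∷ v) ∷ (true ∷ v) ∷ []) (allVecs n)

count : (V → Bool) → ℕ
count p = length (filterᵇ p (allVecs 8))

-- The standard non-degenerate hyperbolic quadratic form on GF(2)^8
-- Q(x) = x0 x1 + x2 x3 + x4 x5 + x6 x7  (every Q^+(7,2) is projectively
-- equivalent to the one it defines).
Qf : V → Bool
Qf (x0 ∷ x1 ∷ x2 ∷ x3 ∷ x4 ∷ x5 ∷ x6 ∷ x7 ∷ []) =
  ((x0 ∧ x1) xor (x2 ∧ x3)) xor ((x4 ∧ x5) xor (x6 ∧ x7))

Bf : V → V → Bool
Bf u v = (Qf (u ⊕ v) xor Qf u) xor Qf v

onQ : V → Bool
onQ v = nonzero v ∧ not (Qf v)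

IsSubspace : (V → Bool) → Set
IsSubspace S = T (S zeroV) × (∀ u v → T (S u) → T (S v) → T (S (u ⊕ v)))

-- projective lines (vector dimension 2) and solids (vector dimension 4)
IsLine : (V → Bool) → Set
IsLine L = IsSubspace L × count L ≡ 4

IsSolid : (V → Bool) → Set
IsSolid S = IsSubspace S × count S ≡ 16

IsGenerator : (V → Bool) → Set
IsGenerator Π = IsSolid Π × (∀ v → T (Π v) → Qf v ≡ false)

-- S is a solid meeting Q^+(7,2) in an elliptic quadric Q^-(3,2):
-- the restriction of Qf to S is non-degenerate (polar form has trivial
-- radical on S) and S contains no line of the quadric (Witt index 1).
IsEllipticSolid : (V → Bool) → Set
IsEllipticSolid S =
  IsSolid S ×
  (∀ u → T (S u) → (∀ v → T (S v) → Bf u v ≡ false) → u ≡ zeroV) ×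
  (∀ L → IsLine L → (∀ v → T (L v) → T (S v)) → ¬ (∀ v → T (L v) → Qf v ≡ false))

quadricIn : (V → Bool) → V → Bool
quadricIn S v = S v ∧ onQ v

lineCount : (V → Bool) → V → V → ℕ
lineCount p u v = length (filterᵇ p (u ∷ v ∷ (u ⊕ v) ∷ []))

Vertex : (V → Bool) → V → Set
Vertex Π v = T (onQ v) × ¬ T (Π v)

Adj : (V → Bool) → V → V → Set
Adj Π u v =
  u ≢ v ×
  (lineCount onQ u v ≡ 2
   ⊎ (lineCount onQ u v ≡ 3 × lineCount (λ w → Π w ∧ nonzero w) u v ≡ 1))

IsClique : (V → Bool) → (V → Bool) → Set
IsClique Π C =
  (∀ v → T (C v) → Vertex Π v) ×
  (∀ u v → T (C u) → T (C v) → u ≢ v → Adj Π u v)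

IsMaximalClique : (V → Bool) → (V → Bool) → Set
IsMaximalClique Π C =
  IsClique Π C ×
  (∀ C' → IsClique Π C' → (∀ v → T (C v) → T (C' v)) → ∀ v → T (C' v) → T (C v))

{-# OPTIONS --safe #-}
-- Choose a basis of the solid S. In these coordinates the restriction of Qf to S is one of the
-- 2^10 quadratic forms on GF(2)^4, and an exhaustive check shows that every elliptic one
-- (nondegenerate, with no singular line) has exactly 5 singular points and that every plane
-- containing at most one of them is the tangent plane s^⊥ of one of them.
-- Two points of Q⁻(3,2) span a secant line, so they form a clique. Let a vertex w be adjacent
-- to all five points. For a point P with Bf w P = 0 the line ⟨w,P⟩ is not secant, so w + P ∈ Π;
-- two such points P, P′ would put P + P′ in the totally singular Π, i.e. make ⟨P,P′⟩ a singular
-- line of S. Hence w^⊥ ∩ S contains at most one point of Q⁻(3,2), so Bf w = Bf s on S for a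
-- point s of Q⁻(3,2), and w + s ∈ Π. Now w + s is orthogonal to S, and to Π since Π is totally
-- singular; as Π ∩ S = 0 the space is Π ⊕ S, so w + s = 0.
module Submission where

open import Defs hiding (_⊕_)
open import Data.Bool using (Bool; true; false; _∧_; _∨_; _xor_; not; T)
open import Data.Bool.Properties
  using (xor-comm; xor-assoc; xor-identityˡ; xor-identityʳ; xor-same; ∧-zeroʳ; ∧-identityʳ;
         ∧-distribʳ-∨; ¬-not; T-≡; T-not-≡; T-∧; T-∨; ⇔→≡)
  renaming (_≟_ to _≟ᵇ_)
open import Data.Bool.Solver using (module xor-∧-Solver)
open import Data.List using (List; []; _∷_; length; filterᵇ; concatMap; cartesianProduct)
open import Data.List.Membership.Propositional using (_∈_; lose)
open import Data.List.Membership.Propositional.Properties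
  using (∈-concatMap⁺; ∈-cartesianProduct⁺; ∈-filter⁻)
open import Data.List.Properties using (filter-some; filter-none)
import Data.List.Relation.Unary.All as ListAll
open import Data.List.Relation.Unary.Any as Any using (any?; here; there)
open import Data.Nat using (ℕ; zero; suc; _+_; _^_; _≤_; _<_; z≤n; s≤s)
open import Data.Nat.Properties
  using (+-suc; +-identityʳ; +-comm; m<m+n; <⇒≱; +-cancelˡ-<; <-≤-trans; ≤-trans; ≤-reflexive;
         <⇒≤; n<1+n; ^-monoʳ-<)
  renaming (_≟_ to _≟ℕ_)
open import Data.Product using (_×_; _,_; proj₁; proj₂; ∃; ∃₂; Σ-syntax)
open import Data.Sum using (_⊎_; inj₁; inj₂)
open import Data.Unit using (⊤; tt)
open import Data.Vec using (Vec; []; _∷_; zipWith; replicate; map; tail; _++_)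
open import Data.Vec.Properties
  using (zipWith-comm; zipWith-assoc; zipWith-identityˡ; zipWith-identityʳ; ≡-dec)
open import Data.Vec.Relation.Unary.All using (All; []; _∷_)
open import Function using (_∘_)
open import Function.Bundles using (_⇔_; mk⇔; Equivalence)
open import Relation.Binary.PropositionalEquality
open import Relation.Nullary using (Dec; yes; no; ¬_; ¬?; _×-dec_; _→-dec_; contradiction)
open import Relation.Nullary.Decidable using (T?; map′; from-yes; decidable-stable)

open Equivalence using (to; from)
open ≡-Reasoning

private variable
  n k m : ℕ

-- GF(2)^n

module _ where
  open xor-∧-Solver

  xor-interchange : ∀ a b c d → (a xor b) xor (c xor d) ≡ (a xor c) xor (b xor d)
  xor-interchange = solve 4 (λ a b c d → (a :+ b) :+ (c :+ d) := (a :+ c) :+ (b :+ d)) refl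

  xor-right-comm : ∀ x a b → (x xor a) xor b ≡ (x xor b) xor a
  xor-right-comm = solve 3 (λ x a b → (x :+ a) :+ b := (x :+ b) :+ a) refl

-- Defs._⊕_ and zeroV in every dimension; at n = 8 they agree with them definitionally.
infixl 6 _⊕_

_⊕_ : Vec Bool n → Vec Bool n → Vec Bool n
u ⊕ v = zipWith _xor_ u v

𝟎 : Vec Bool n
𝟎 = replicate _ false

_≟ᵛ_ : (u v : Vec Bool n) → Dec (u ≡ v)
_≟ᵛ_ = ≡-dec _≟ᵇ_

⊕-comm : (u v : Vec Bool n) → u ⊕ v ≡ v ⊕ u
⊕-comm = zipWith-comm xor-comm

⊕-assoc : (u v w : Vec Bool n) → u ⊕ v ⊕ w ≡ u ⊕ (v ⊕ w)
⊕-assoc = zipWith-assoc xor-assoc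

⊕-identityˡ : (u : Vec Bool n) → 𝟎 ⊕ u ≡ u
⊕-identityˡ = zipWith-identityˡ xor-identityˡ

⊕-identityʳ : (u : Vec Bool n) → u ⊕ 𝟎 ≡ u
⊕-identityʳ = zipWith-identityʳ xor-identityʳ

⊕-self : (u : Vec Bool n) → u ⊕ u ≡ 𝟎
⊕-self [] = refl
⊕-self (a ∷ u) = cong₂ _∷_ (xor-same a) (⊕-self u)

⊕-cancelʳ : (u v : Vec Bool n) → u ⊕ v ⊕ v ≡ u
⊕-cancelʳ u v = begin
  u ⊕ v ⊕ v    ≡⟨ ⊕-assoc u v v ⟩
  u ⊕ (v ⊕ v)  ≡⟨ cong (u ⊕_) (⊕-self v) ⟩
  u ⊕ 𝟎        ≡⟨ ⊕-identityʳ u ⟩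
  u            ∎

⊕-cancelˡ : (u v : Vec Bool n) → u ⊕ (u ⊕ v) ≡ v
⊕-cancelˡ u v = begin
  u ⊕ (u ⊕ v)  ≡⟨ cong (u ⊕_) (⊕-comm u v) ⟩
  u ⊕ (v ⊕ u)  ≡⟨ ⊕-assoc u v u ⟨
  u ⊕ v ⊕ u    ≡⟨ cong (_⊕ u) (⊕-comm u v) ⟩
  v ⊕ u ⊕ u    ≡⟨ ⊕-cancelʳ v u ⟩
  v            ∎

⊕≡𝟎⇒≡ : {u v : Vec Bool n} → u ⊕ v ≡ 𝟎 → u ≡ v
⊕≡𝟎⇒≡ {u = u} {v} u⊕v≡𝟎 = begin
  u            ≡⟨ ⊕-cancelʳ u v ⟨
  u ⊕ v ⊕ v    ≡⟨ cong (_⊕ v) u⊕v≡𝟎 ⟩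
  𝟎 ⊕ v        ≡⟨ ⊕-identityˡ v ⟩
  v            ∎

⊕-interchange : (a b c d : Vec Bool n) → (a ⊕ b) ⊕ (c ⊕ d) ≡ (a ⊕ c) ⊕ (b ⊕ d)
⊕-interchange [] [] [] [] = refl
⊕-interchange (a ∷ as) (b ∷ bs) (c ∷ cs) (d ∷ ds) =
  cong₂ _∷_ (xor-interchange a b c d) (⊕-interchange as bs cs ds)

nonzero≡false⇔≡𝟎 : {u : Vec Bool n} → nonzero u ≡ false ⇔ u ≡ 𝟎
nonzero≡false⇔≡𝟎 {u = []}        = mk⇔ (λ _ → refl) (λ _ → refl)
nonzero≡false⇔≡𝟎 {u = true ∷ u}  = mk⇔ (λ ()) (λ ())
nonzero≡false⇔≡𝟎 {u = false ∷ u} =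
  mk⇔ (cong (false ∷_) ∘ to nonzero≡false⇔≡𝟎) (from nonzero≡false⇔≡𝟎 ∘ cong tail)

T-nonzero : {u : Vec Bool n} → T (nonzero u) ⇔ u ≢ 𝟎
T-nonzero = mk⇔ (λ nz u≡𝟎 → subst T (from nonzero≡false⇔≡𝟎 u≡𝟎) nz)
                (λ u≢𝟎 → from T-≡ (¬-not (u≢𝟎 ∘ to nonzero≡false⇔≡𝟎)))

¬T⇔≡false : {b : Bool} → (¬ T b) ⇔ b ≡ false
¬T⇔≡false {false} = mk⇔ (λ _ → refl) (λ _ ())
¬T⇔≡false {true}  = mk⇔ (λ ¬t → contradiction _ ¬t) (λ ())

-- Quantifiers and counting over GF(2)^n

module _ {A : Set} {xs : List A} (complete : ∀ x → x ∈ xs) {P : A → Set} (P? : ∀ x → Dec (P x)) where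

  ∀-enum? : Dec (∀ x → P x)
  ∀-enum? = map′ (λ all x → ListAll.lookup all (complete x)) (λ f → ListAll.tabulate (λ {x} _ → f x))
                 (ListAll.all? P? xs)

  ∃-enum? : Dec (∃ P)
  ∃-enum? = map′ Any.satisfied (λ (x , px) → lose (complete x) px) (any? P? xs)

allVecs-complete : (v : Vec Bool n) → v ∈ allVecs n
allVecs-complete [] = here refl
allVecs-complete (false ∷ v) = ∈-concatMap⁺ _ (Any.map (λ { refl → here refl }) (allVecs-complete v))
allVecs-complete (true ∷ v) = ∈-concatMap⁺ _ (Any.map (λ { refl → there (here refl) }) (allVecs-complete v))

∀ᵛ? : {P : Vec Bool n → Set} → (∀ v → Dec (P v)) → Dec (∀ v → P v)
∀ᵛ? = ∀-enum? allVecs-complete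

∃ᵛ? : {P : Vec Bool n → Set} → (∀ v → Dec (P v)) → Dec (∃ P)
∃ᵛ? = ∃-enum? allVecs-complete

AtMostOne : {A : Set} → (A → Set) → Set
AtMostOne P = ∀ x → P x → ∀ y → P y → x ≡ y

atMostOne? : {P : Vec Bool n → Set} → (∀ v → Dec (P v)) → Dec (AtMostOne P)
atMostOne? P? = ∀ᵛ? λ u → P? u →-dec ∀ᵛ? λ v → P? v →-dec u ≟ᵛ v

_⊆ᵇ_ : {A : Set} → (A → Bool) → (A → Bool) → Set
p ⊆ᵇ q = ∀ x → T (p x) → T (q x)

module _ {A : Set} where

  length-filterᵇ-∨ : (p q : A → Bool) → (∀ x → T (p x) → ¬ T (q x)) → ∀ xs →
    length (filterᵇ (λ x → p x ∨ q x) xs) ≡ length (filterᵇ p xs) + length (filterᵇ q xs)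
  length-filterᵇ-∨ p q disjoint [] = refl
  length-filterᵇ-∨ p q disjoint (x ∷ xs) with p x in px | q x in qx
  ... | true  | true  = contradiction (subst T (sym qx) _) (disjoint x (subst T (sym px) _))
  ... | true  | false = cong suc (length-filterᵇ-∨ p q disjoint xs)
  ... | false | true  = trans (cong suc (length-filterᵇ-∨ p q disjoint xs)) (sym (+-suc _ _))
  ... | false | false = length-filterᵇ-∨ p q disjoint xs

  filterᵇ-nonempty : (p : A → Bool) (xs : List A) → 0 < length (filterᵇ p xs) → ∃ λ x → T (p x)
  filterᵇ-nonempty p xs 0<len with filterᵇ p xs in eq
  ... | x ∷ _ = x , proj₂ (∈-filter⁻ (T? ∘ p) {xs = xs} (subst (x ∈_) (sym eq) (here refl)))

-- Opaque so that unification compares counts syntactically instead of unfolding the filter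
-- over all 2^n vectors; count p is # p at n = 8.
opaque
  # : (Vec Bool n → Bool) → ℕ
  # p = length (filterᵇ p (allVecs _))

  #-cong : {p q : Vec Bool n → Bool} → (∀ x → p x ≡ q x) → # p ≡ # q
  #-cong {n} {p} {q} p≗q = go (allVecs n)
    where
    go : ∀ xs → length (filterᵇ p xs) ≡ length (filterᵇ q xs)
    go [] = refl
    go (x ∷ xs) rewrite p≗q x with q x
    ... | true  = cong suc (go xs)
    ... | false = go xs

  #-∨ : {p q : Vec Bool n → Bool} → (∀ x → T (p x) → ¬ T (q x)) → # (λ x → p x ∨ q x) ≡ # p + # q
  #-∨ {p = p} {q} disjoint = length-filterᵇ-∨ p q disjoint (allVecs _)

  #-split : (p q : Vec Bool n → Bool) → # p ≡ # (λ x → p x ∧ q x) + # (λ x → p x ∧ not (q x))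
  #-split p q = trans (#-cong (λ x → split (p x) (q x))) (#-∨ λ x → disjoint (p x) (q x))
    where
    split : ∀ a b → a ≡ (a ∧ b) ∨ (a ∧ not b)
    split false b     = refl
    split true  false = refl
    split true  true  = refl
    disjoint : ∀ a b → T (a ∧ b) → ¬ T (a ∧ not b)
    disjoint true true _ ()

  #-pos : {p : Vec Bool n → Bool} (x : Vec Bool n) → T (p x) → 0 < # p
  #-pos {p = p} x px = filter-some (T? ∘ p) (lose (allVecs-complete x) px)

  #-witness : {p : Vec Bool n → Bool} → 0 < # p → ∃ λ x → T (p x)
  #-witness {p = p} = filterᵇ-nonempty p (allVecs _)

  #-∷ : (p : Vec Bool (suc n) → Bool) → # p ≡ # (λ v → p (false ∷ v)) + # (λ v → p (true ∷ v))
  #-∷ {n} p = go (allVecs n)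
    where
    go : ∀ vs → length (filterᵇ p (concatMap (λ v → (false ∷ v) ∷ (true ∷ v) ∷ []) vs))
              ≡ length (filterᵇ (λ v → p (false ∷ v)) vs) + length (filterᵇ (λ v → p (true ∷ v)) vs)
    go [] = refl
    go (v ∷ vs) with p (false ∷ v)
    ... | true  with p (true ∷ v)
    ...   | true  = cong suc (trans (cong suc (go vs)) (sym (+-suc _ _)))
    ...   | false = cong suc (go vs)
    go (v ∷ vs) | false with p (true ∷ v)
    ...   | true  = trans (cong suc (go vs)) (sym (+-suc _ _))
    ...   | false = go vs

  #-true : # (λ (_ : Vec Bool n) → true) ≡ 2 ^ n
  #-true {zero} = refl
  #-true {suc n} = begin
    # (λ (_ : Vec Bool (suc n)) → true)  ≡⟨ #-∷ (λ (_ : Vec Bool (suc n)) → true) ⟩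
    # true₁ + # true₁                    ≡⟨ cong₂ _+_ (#-true {n}) (#-true {n}) ⟩
    2 ^ n + 2 ^ n                        ≡⟨ cong (2 ^ n +_) (+-identityʳ (2 ^ n)) ⟨
    2 ^ suc n                            ∎
    where
    true₁ : Vec Bool n → Bool
    true₁ _ = true

  #-𝟎∧ : (p : Vec Bool n → Bool) → # (λ x → not (nonzero x) ∧ p x) ≡ # (λ (_ : Vec Bool 0) → p 𝟎)
  #-𝟎∧ {zero} p = #-cong {0} {λ x → not (nonzero x) ∧ p x} {λ _ → p 𝟎} λ { [] → refl }
  #-𝟎∧ {suc n} p = begin
    # (λ x → not (nonzero x) ∧ p x)
      ≡⟨ #-∷ (λ x → not (nonzero x) ∧ p x) ⟩
    # (λ v → not (nonzero v) ∧ p (false ∷ v)) + # none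
      ≡⟨ cong₂ _+_ (#-𝟎∧ (λ v → p (false ∷ v))) #none≡0 ⟩
    # (λ (_ : Vec Bool 0) → p 𝟎) + 0
      ≡⟨ +-identityʳ _ ⟩
    # (λ (_ : Vec Bool 0) → p 𝟎)
      ∎
    where
    none : Vec Bool n → Bool
    none _ = false
    #none≡0 : # none ≡ 0
    #none≡0 = cong length (filter-none (T? ∘ none) {xs = allVecs n} (ListAll.tabulate λ _ ()))

  count≡# : (p : V → Bool) → count p ≡ # p
  count≡# p = refl

#-translate : (p : Vec Bool n → Bool) (a : Vec Bool n) → # (λ x → p (x ⊕ a)) ≡ # p
#-translate {zero} p [] = #-cong {0} λ { [] → refl }
#-translate {suc n} p (false ∷ a) = begin
  # (λ x → p (x ⊕ (false ∷ a)))
    ≡⟨ #-∷ (λ x → p (x ⊕ (false ∷ a))) ⟩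
  # (λ v → p (false ∷ v ⊕ a)) + # (λ v → p (true ∷ v ⊕ a))
    ≡⟨ cong₂ _+_ (#-translate p₀ a) (#-translate p₁ a) ⟩
  # p₀ + # p₁
    ≡⟨ #-∷ p ⟨
  # p
    ∎
  where
  p₀ p₁ : Vec Bool n → Bool
  p₀ v = p (false ∷ v)
  p₁ v = p (true ∷ v)
#-translate {suc n} p (true ∷ a) = begin
  # (λ x → p (x ⊕ (true ∷ a)))
    ≡⟨ #-∷ (λ x → p (x ⊕ (true ∷ a))) ⟩
  # (λ v → p (true ∷ v ⊕ a)) + # (λ v → p (false ∷ v ⊕ a))
    ≡⟨ cong₂ _+_ (#-translate p₁ a) (#-translate p₀ a) ⟩
  # p₁ + # p₀
    ≡⟨ +-comm (# p₁) (# p₀) ⟩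
  # p₀ + # p₁
    ≡⟨ #-∷ p ⟨
  # p
    ∎
  where
  p₀ p₁ : Vec Bool n → Bool
  p₀ v = p (false ∷ v)
  p₁ v = p (true ∷ v)

#-⊆-split : {p q : Vec Bool n → Bool} → p ⊆ᵇ q → # q ≡ # p + # (λ x → q x ∧ not (p x))
#-⊆-split {p = p} {q} p⊆q = trans (#-split q p) (cong (_+ # (λ x → q x ∧ not (p x))) (#-cong ∧-absorbs))
  where
  ∧-absorbs : ∀ x → q x ∧ p x ≡ p x
  ∧-absorbs x with p x in px | q x in qx
  ... | false | _     = ∧-zeroʳ _
  ... | true  | true  = refl
  ... | true  | false = contradiction (p⊆q x (subst T (sym px) _)) (subst (¬_ ∘ T) (sym qx) λ ())

⊆∧#≤⇒⊇ : {p q : Vec Bool n → Bool} → p ⊆ᵇ q → # q ≤ # p → q ⊆ᵇ p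
⊆∧#≤⇒⊇ {p = p} {q} p⊆q #q≤#p x qx with T? (p x)
... | yes px = px
... | no ¬px = contradiction (subst (_≤ # p) (#-⊆-split p⊆q) #q≤#p) (<⇒≱ (m<m+n (# p) (#-pos x x∈q∖p)))
  where
  x∈q∖p : T (q x ∧ not (p x))
  x∈q∖p = from T-∧ (qx , from T-not-≡ (to ¬T⇔≡false ¬px))

⊆∧#<⇒∃∖ : {p q : Vec Bool n → Bool} → p ⊆ᵇ q → # p < # q → ∃ λ x → T (q x) × ¬ T (p x)
⊆∧#<⇒∃∖ {p = p} {q} p⊆q #p<#q =
  let x , x∈q∖p = #-witness 0<#q∖p
      x∈q , x∉p = to T-∧ x∈q∖p
  in x , x∈q , from ¬T⇔≡false (to T-not-≡ x∉p)
  where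
  0<#q∖p : 0 < # (λ x → q x ∧ not (p x))
  0<#q∖p = +-cancelˡ-< (# p) 0 _ (subst₂ _<_ (sym (+-identityʳ (# p))) (#-⊆-split p⊆q) #p<#q)

-- Spans and bases

Closed : (Vec Bool n → Bool) → Set
Closed W = ∀ u v → T (W u) → T (W v) → T (W (u ⊕ v))

lin : Vec (Vec Bool n) k → Vec Bool k → Vec Bool n
lin [] [] = 𝟎
lin (e ∷ es) (false ∷ c) = lin es c
lin (e ∷ es) (true ∷ c) = e ⊕ lin es c

⟨_⟩ : Vec (Vec Bool n) k → Vec Bool n → Bool
⟨ [] ⟩ x = not (nonzero x)
⟨ e ∷ es ⟩ x = ⟨ es ⟩ x ∨ ⟨ es ⟩ (x ⊕ e)

Independent : Vec (Vec Bool n) k → Set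
Independent [] = ⊤
Independent (e ∷ es) = ¬ T (⟨ es ⟩ e) × Independent es

lin-𝟎 : (es : Vec (Vec Bool n) k) → lin es 𝟎 ≡ 𝟎
lin-𝟎 [] = refl
lin-𝟎 (e ∷ es) = lin-𝟎 es

lin-⊕ : (es : Vec (Vec Bool n) k) (c d : Vec Bool k) → lin es (c ⊕ d) ≡ lin es c ⊕ lin es d
lin-⊕ [] [] [] = sym (⊕-self 𝟎)
lin-⊕ (e ∷ es) (false ∷ c) (false ∷ d) = lin-⊕ es c d
lin-⊕ (e ∷ es) (false ∷ c) (true ∷ d) = begin
  e ⊕ lin es (c ⊕ d)              ≡⟨ cong (e ⊕_) (lin-⊕ es c d) ⟩
  e ⊕ (lin es c ⊕ lin es d)       ≡⟨ ⊕-assoc e _ _ ⟨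
  e ⊕ lin es c ⊕ lin es d         ≡⟨ cong (_⊕ lin es d) (⊕-comm e _) ⟩
  lin es c ⊕ e ⊕ lin es d         ≡⟨ ⊕-assoc _ e _ ⟩
  lin es c ⊕ (e ⊕ lin es d)       ∎
lin-⊕ (e ∷ es) (true ∷ c) (false ∷ d) = trans (cong (e ⊕_) (lin-⊕ es c d)) (sym (⊕-assoc e _ _))
lin-⊕ (e ∷ es) (true ∷ c) (true ∷ d) = begin
  lin es (c ⊕ d)                  ≡⟨ lin-⊕ es c d ⟩
  lin es c ⊕ lin es d             ≡⟨ ⊕-identityˡ _ ⟨
  𝟎 ⊕ (lin es c ⊕ lin es d)       ≡⟨ cong (_⊕ (lin es c ⊕ lin es d)) (⊕-self e) ⟨
  e ⊕ e ⊕ (lin es c ⊕ lin es d)   ≡⟨ ⊕-interchange e e _ _ ⟩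
  e ⊕ lin es c ⊕ (e ⊕ lin es d)   ∎

lin∈⟨⟩ : (es : Vec (Vec Bool n) k) (c : Vec Bool k) → T (⟨ es ⟩ (lin es c))
lin∈⟨⟩ {n} [] [] = from T-not-≡ (from (nonzero≡false⇔≡𝟎 {n}) refl)
lin∈⟨⟩ (e ∷ es) (false ∷ c) = from T-∨ (inj₁ (lin∈⟨⟩ es c))
lin∈⟨⟩ (e ∷ es) (true ∷ c) = from T-∨ (inj₂ (subst (T ∘ ⟨ es ⟩) e⊕l⊕e≡l (lin∈⟨⟩ es c)))
  where
  e⊕l⊕e≡l : lin es c ≡ e ⊕ lin es c ⊕ e
  e⊕l⊕e≡l = sym (trans (cong (_⊕ e) (⊕-comm e _)) (⊕-cancelʳ _ e))

∈⟨⟩⇒lin : (es : Vec (Vec Bool n) k) {x : Vec Bool n} → T (⟨ es ⟩ x) → ∃ λ c → lin es c ≡ x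
∈⟨⟩⇒lin [] x∈ = [] , sym (to nonzero≡false⇔≡𝟎 (to T-not-≡ x∈))
∈⟨⟩⇒lin (e ∷ es) {x} x∈ with to T-∨ x∈
... | inj₁ x∈⟨es⟩ = let c , lc≡x = ∈⟨⟩⇒lin es x∈⟨es⟩ in false ∷ c , lc≡x
... | inj₂ x⊕e∈⟨es⟩ = let c , lc≡x⊕e = ∈⟨⟩⇒lin es x⊕e∈⟨es⟩ in true ∷ c , (begin
  e ⊕ lin es c   ≡⟨ cong (e ⊕_) lc≡x⊕e ⟩
  e ⊕ (x ⊕ e)    ≡⟨ cong (e ⊕_) (⊕-comm x e) ⟩
  e ⊕ (e ⊕ x)    ≡⟨ ⊕-cancelˡ e x ⟩
  x              ∎)

⟨⟩-closed : (es : Vec (Vec Bool n) k) → Closed ⟨ es ⟩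
⟨⟩-closed es x y x∈ y∈ with ∈⟨⟩⇒lin es x∈ | ∈⟨⟩⇒lin es y∈
... | c , refl | d , refl = subst (T ∘ ⟨ es ⟩) (lin-⊕ es c d) (lin∈⟨⟩ es (c ⊕ d))

lin≡𝟎⇒≡𝟎 : {es : Vec (Vec Bool n) k} → Independent es → (c : Vec Bool k) → lin es c ≡ 𝟎 → c ≡ 𝟎
lin≡𝟎⇒≡𝟎 {es = []} _ [] _ = refl
lin≡𝟎⇒≡𝟎 {es = e ∷ es} (_ , ind) (false ∷ c) lc≡𝟎 = cong (false ∷_) (lin≡𝟎⇒≡𝟎 ind c lc≡𝟎)
lin≡𝟎⇒≡𝟎 {es = e ∷ es} (e∉ , _) (true ∷ c) e⊕lc≡𝟎 =
  contradiction (subst (T ∘ ⟨ es ⟩) (sym (⊕≡𝟎⇒≡ e⊕lc≡𝟎)) (lin∈⟨⟩ es c)) e∉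

lin-injective : {es : Vec (Vec Bool n) k} → Independent es → {c d : Vec Bool k} → lin es c ≡ lin es d → c ≡ d
lin-injective {es = es} ind {c} {d} lc≡ld = ⊕≡𝟎⇒≡ (lin≡𝟎⇒≡𝟎 ind (c ⊕ d) (begin
  lin es (c ⊕ d)        ≡⟨ lin-⊕ es c d ⟩
  lin es c ⊕ lin es d   ≡⟨ cong (_⊕ lin es d) lc≡ld ⟩
  lin es d ⊕ lin es d   ≡⟨ ⊕-self _ ⟩
  𝟎                     ∎))

nonzero-lin : {es : Vec (Vec Bool n) k} → Independent es → (c : Vec Bool k) → nonzero (lin es c) ≡ nonzero c
nonzero-lin {es = es} ind c = ⇔→≡ (mk⇔
  (from nonzero≡false⇔≡𝟎 ∘ lin≡𝟎⇒≡𝟎 ind c ∘ to nonzero≡false⇔≡𝟎)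
  (λ nz≡false → from nonzero≡false⇔≡𝟎
     (trans (cong (lin es) (to nonzero≡false⇔≡𝟎 nz≡false)) (lin-𝟎 es))))

#-⟨⟩∧ : {es : Vec (Vec Bool n) k} → Independent es → (p : Vec Bool n → Bool) →
        # (λ x → ⟨ es ⟩ x ∧ p x) ≡ # (λ c → p (lin es c))
#-⟨⟩∧ {es = []} _ p = trans (#-𝟎∧ p) (#-cong {0} λ { [] → refl })
#-⟨⟩∧ {es = e ∷ es} (e∉ , ind) p = begin
  # (λ x → (⟨ es ⟩ x ∨ ⟨ es ⟩ (x ⊕ e)) ∧ p x)
    ≡⟨ #-cong (λ x → ∧-distribʳ-∨ (p x) (⟨ es ⟩ x) _) ⟩
  # (λ x → ⟨ es ⟩ x ∧ p x ∨ ⟨ es ⟩ (x ⊕ e) ∧ p x)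
    ≡⟨ #-∨ disjoint ⟩
  # (λ x → ⟨ es ⟩ x ∧ p x) + # (λ x → ⟨ es ⟩ (x ⊕ e) ∧ p x)
    ≡⟨ cong₂ _+_ (#-⟨⟩∧ ind p) shifted ⟩
  # (λ c → p (lin es c)) + # (λ c → p (e ⊕ lin es c))
    ≡⟨ #-∷ (λ c → p (lin (e ∷ es) c)) ⟨
  # (λ c → p (lin (e ∷ es) c))
    ∎
  where
  disjoint : ∀ x → T (⟨ es ⟩ x ∧ p x) → ¬ T (⟨ es ⟩ (x ⊕ e) ∧ p x)
  disjoint x x∈ x⊕e∈ = e∉ (subst (T ∘ ⟨ es ⟩) (⊕-cancelˡ x e)
                           (⟨⟩-closed es x (x ⊕ e) (proj₁ (to T-∧ x∈)) (proj₁ (to T-∧ x⊕e∈))))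
  shifted : # (λ x → ⟨ es ⟩ (x ⊕ e) ∧ p x) ≡ # (λ c → p (e ⊕ lin es c))
  shifted = begin
    # (λ x → ⟨ es ⟩ (x ⊕ e) ∧ p x)
      ≡⟨ #-cong (λ x → cong (λ y → ⟨ es ⟩ (x ⊕ e) ∧ p y) (⊕-cancelʳ x e)) ⟨
    # (λ x → ⟨ es ⟩ (x ⊕ e) ∧ p (x ⊕ e ⊕ e))
      ≡⟨ #-translate (λ y → ⟨ es ⟩ y ∧ p (y ⊕ e)) e ⟩
    # (λ y → ⟨ es ⟩ y ∧ p (y ⊕ e))
      ≡⟨ #-⟨⟩∧ ind (λ y → p (y ⊕ e)) ⟩
    # (λ c → p (lin es c ⊕ e))
      ≡⟨ #-cong (λ c → cong p (⊕-comm _ e)) ⟩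
    # (λ c → p (e ⊕ lin es c))
      ∎

#⟨⟩ : {es : Vec (Vec Bool n) k} → Independent es → # ⟨ es ⟩ ≡ 2 ^ k
#⟨⟩ {n} {k} {es} ind = begin
  # ⟨ es ⟩                          ≡⟨ #-cong (λ x → ∧-identityʳ (⟨ es ⟩ x)) ⟨
  # (λ x → ⟨ es ⟩ x ∧ true)         ≡⟨ #-⟨⟩∧ ind (λ _ → true) ⟩
  # (λ (_ : Vec Bool k) → true)     ≡⟨ #-true ⟩
  2 ^ k                             ∎

module _ {W : Vec Bool n → Bool} (𝟎∈W : T (W 𝟎)) (closed : Closed W) where

  ⟨⟩⊆ : {es : Vec (Vec Bool n) k} → All (T ∘ W) es → ⟨ es ⟩ ⊆ᵇ W
  ⟨⟩⊆ {es = es} es⊆W x x∈ with ∈⟨⟩⇒lin es x∈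
  ... | c , refl = lin∈W es⊆W c
    where
    lin∈W : {es : Vec (Vec Bool n) k} → All (T ∘ W) es → ∀ c → T (W (lin es c))
    lin∈W []            []          = 𝟎∈W
    lin∈W (_   ∷ es⊆W) (false ∷ c) = lin∈W es⊆W c
    lin∈W (e∈W ∷ es⊆W) (true ∷ c)  = closed _ _ e∈W (lin∈W es⊆W c)

  IndependentIn : ℕ → Set
  IndependentIn j = Σ[ es ∈ Vec (Vec Bool n) j ] Independent es × All (T ∘ W) es

  independent-in : ∀ j → 2 ^ j ≤ # W → IndependentIn j
  independent-in zero    _         = [] , tt , []
  independent-in (suc j) 2^1+j≤#W = extend (independent-in j (≤-trans (<⇒≤ 2^j<2^1+j) 2^1+j≤#W))
    where
    2^j<2^1+j : 2 ^ j < 2 ^ suc j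
    2^j<2^1+j = ^-monoʳ-< 2 (s≤s (s≤s z≤n)) (n<1+n j)
    extend : IndependentIn j → IndependentIn (suc j)
    extend (es , ind , es⊆W) =
      let x , x∈W , x∉⟨es⟩ = ⊆∧#<⇒∃∖ (⟨⟩⊆ es⊆W) #⟨es⟩<#W
      in x ∷ es , (x∉⟨es⟩ , ind) , x∈W ∷ es⊆W
      where
      #⟨es⟩<#W : # ⟨ es ⟩ < # W
      #⟨es⟩<#W = <-≤-trans (subst (_< 2 ^ suc j) (sym (#⟨⟩ ind)) 2^j<2^1+j) 2^1+j≤#W

record Basis (W : Vec Bool n → Bool) (k : ℕ) : Set where
  field
    vectors     : Vec (Vec Bool n) k
    independent : Independent vectors
    span⊆       : ⟨ vectors ⟩ ⊆ᵇ W
    ⊆span       : W ⊆ᵇ ⟨ vectors ⟩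

-- Opaque so that the vectors of a basis are never computed by unfolding the search.
opaque
  basis : {W : Vec Bool n → Bool} → T (W 𝟎) → Closed W → # W ≡ 2 ^ k → Basis W k
  basis {k = k} 𝟎∈W closed #W≡2^k with independent-in 𝟎∈W closed k (≤-reflexive (sym #W≡2^k))
  ... | es , ind , es⊆W = record
    { vectors     = es
    ; independent = ind
    ; span⊆       = ⟨⟩⊆ 𝟎∈W closed es⊆W
    ; ⊆span       = ⊆∧#≤⇒⊇ (⟨⟩⊆ 𝟎∈W closed es⊆W) (≤-reflexive (trans #W≡2^k (sym (#⟨⟩ ind))))
    }

⟨++⟩⇒⊕ : (es : Vec (Vec Bool n) k) (fs : Vec (Vec Bool n) m) {x : Vec Bool n} → T (⟨ es ++ fs ⟩ x) →
         ∃₂ λ y z → T (⟨ es ⟩ y) × T (⟨ fs ⟩ z) × x ≡ y ⊕ z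
⟨++⟩⇒⊕ {n} [] fs {x} x∈ = 𝟎 , x , lin∈⟨⟩ {n} [] [] , x∈ , sym (⊕-identityˡ x)
⟨++⟩⇒⊕ (e ∷ es) fs {x} x∈ with to T-∨ x∈
... | inj₁ x∈⟨es++fs⟩ =
  let y , z , y∈ , z∈ , x≡y⊕z = ⟨++⟩⇒⊕ es fs x∈⟨es++fs⟩ in y , z , from T-∨ (inj₁ y∈) , z∈ , x≡y⊕z
... | inj₂ x⊕e∈⟨es++fs⟩ =
  let y , z , y∈ , z∈ , x⊕e≡y⊕z = ⟨++⟩⇒⊕ es fs x⊕e∈⟨es++fs⟩
  in y ⊕ e , z , from T-∨ (inj₂ (subst (T ∘ ⟨ es ⟩) (sym (⊕-cancelʳ y e)) y∈)) , z∈ , (begin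
    x              ≡⟨ ⊕-cancelʳ x e ⟨
    x ⊕ e ⊕ e      ≡⟨ cong (_⊕ e) x⊕e≡y⊕z ⟩
    y ⊕ z ⊕ e      ≡⟨ ⊕-assoc y z e ⟩
    y ⊕ (z ⊕ e)    ≡⟨ cong (y ⊕_) (⊕-comm z e) ⟩
    y ⊕ (e ⊕ z)    ≡⟨ ⊕-assoc y e z ⟨
    y ⊕ e ⊕ z      ∎)

Independent-++ : {es : Vec (Vec Bool n) k} {fs : Vec (Vec Bool n) m} → Independent es → Independent fs →
                 (∀ x → T (⟨ es ⟩ x) → T (⟨ fs ⟩ x) → x ≡ 𝟎) → Independent (es ++ fs)
Independent-++ {es = []} _ ind-fs _ = ind-fs
Independent-++ {es = e ∷ es} {fs} (e∉⟨es⟩ , ind-es) ind-fs trivial =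
  e∉⟨es++fs⟩ , Independent-++ ind-es ind-fs (λ x x∈⟨es⟩ → trivial x (from T-∨ (inj₁ x∈⟨es⟩)))
  where
  e∉⟨es++fs⟩ : ¬ T (⟨ es ++ fs ⟩ e)
  e∉⟨es++fs⟩ e∈ with ⟨++⟩⇒⊕ es fs e∈
  ... | y , z , y∈ , z∈ , e≡y⊕z = e∉⟨es⟩ (subst (T ∘ ⟨ es ⟩) y≡e y∈)
    where
    z⊕e≡y : z ⊕ e ≡ y
    z⊕e≡y = begin
      z ⊕ e          ≡⟨ cong (z ⊕_) e≡y⊕z ⟩
      z ⊕ (y ⊕ z)    ≡⟨ ⊕-comm z _ ⟩
      y ⊕ z ⊕ z      ≡⟨ ⊕-cancelʳ y z ⟩
      y              ∎
    z≡𝟎 : z ≡ 𝟎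
    z≡𝟎 = trivial z (from T-∨ (inj₂ (subst (T ∘ ⟨ es ⟩) (sym z⊕e≡y) y∈))) z∈
    y≡e : y ≡ e
    y≡e = sym (trans e≡y⊕z (trans (cong (y ⊕_) z≡𝟎) (⊕-identityʳ y)))

⊕-decomposition : {W₁ W₂ : Vec Bool (k + m) → Bool} → Basis W₁ k → Basis W₂ m →
                  (∀ x → T (W₁ x) → T (W₂ x) → x ≡ 𝟎) →
                  ∀ x → ∃₂ λ y z → T (W₁ y) × T (W₂ z) × x ≡ y ⊕ z
⊕-decomposition {W₁ = W₁} {W₂} B₁ B₂ trivial x = split (everything x _)
  where
  open Basis B₁ using () renaming (vectors to es; independent to ind-es; span⊆ to ⟨es⟩⊆W₁)
  open Basis B₂ using () renaming (vectors to fs; independent to ind-fs; span⊆ to ⟨fs⟩⊆W₂)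
  ind : Independent (es ++ fs)
  ind = Independent-++ ind-es ind-fs λ y y∈⟨es⟩ y∈⟨fs⟩ →
    trivial y (⟨es⟩⊆W₁ y y∈⟨es⟩) (⟨fs⟩⊆W₂ y y∈⟨fs⟩)
  everything : (λ _ → true) ⊆ᵇ ⟨ es ++ fs ⟩
  everything = ⊆∧#≤⇒⊇ (λ _ _ → _) (≤-reflexive (trans #-true (sym (#⟨⟩ ind))))
  split : T (⟨ es ++ fs ⟩ x) → ∃₂ λ y z → T (W₁ y) × T (W₂ z) × x ≡ y ⊕ z
  split x∈ with ⟨++⟩⇒⊕ es fs x∈
  ... | y , z , y∈ , z∈ , x≡y⊕z = y , z , ⟨es⟩⊆W₁ y y∈ , ⟨fs⟩⊆W₂ z z∈ , x≡y⊕z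

-- Quadratic forms in coordinates

dot : Vec Bool k → Vec Bool k → Bool
dot [] [] = false
dot (a ∷ r) (false ∷ c) = dot r c
dot (a ∷ r) (true ∷ c) = a xor dot r c

dot-⊕ʳ : (r c d : Vec Bool k) → dot r (c ⊕ d) ≡ dot r c xor dot r d
dot-⊕ʳ [] [] [] = refl
dot-⊕ʳ (a ∷ r) (false ∷ c) (false ∷ d) = dot-⊕ʳ r c d
dot-⊕ʳ (a ∷ r) (false ∷ c) (true ∷ d) = trans (cong (a xor_) (dot-⊕ʳ r c d)) (xor-left-comm a (dot r c) (dot r d))
  where
  open xor-∧-Solver
  xor-left-comm : ∀ a x y → a xor (x xor y) ≡ x xor (a xor y)
  xor-left-comm = solve 3 (λ a x y → a :+ (x :+ y) := x :+ (a :+ y)) refl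
dot-⊕ʳ (a ∷ r) (true ∷ c) (false ∷ d) = trans (cong (a xor_) (dot-⊕ʳ r c d)) (sym (xor-assoc a (dot r c) (dot r d)))
dot-⊕ʳ (a ∷ r) (true ∷ c) (true ∷ d) = trans (dot-⊕ʳ r c d) (xor-cancel a (dot r c) (dot r d))
  where
  open xor-∧-Solver
  xor-cancel : ∀ a x y → x xor y ≡ (a xor x) xor (a xor y)
  xor-cancel = solve 3 (λ a x y → x :+ y := (a :+ x) :+ (a :+ y)) refl

-- (q , r , γ) is the form  q c₀ + c₀ (r · c) + γ(c)  in the coordinates c₀ ∷ c.
QuadForm : ℕ → Set
QuadForm zero = ⊤
QuadForm (suc k) = Bool × Vec Bool k × QuadForm k

⟦_⟧ : QuadForm k → Vec Bool k → Bool
⟦_⟧ {zero}  _           []          = false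
⟦_⟧ {suc k} (q , r , γ) (false ∷ c) = ⟦ γ ⟧ c
⟦_⟧ {suc k} (q , r , γ) (true ∷ c)  = (q xor dot r c) xor ⟦ γ ⟧ c

polar : QuadForm k → Vec Bool k → Vec Bool k → Bool
polar γ c d = (⟦ γ ⟧ (c ⊕ d) xor ⟦ γ ⟧ c) xor ⟦ γ ⟧ d

singular : QuadForm k → Vec Bool k → Bool
singular γ c = nonzero c ∧ not (⟦ γ ⟧ c)

allForms : ∀ k → List (QuadForm k)
allForms zero    = tt ∷ []
allForms (suc k) = cartesianProduct (false ∷ true ∷ []) (cartesianProduct (allVecs k) (allForms k))

allForms-complete : (γ : QuadForm k) → γ ∈ allForms k
allForms-complete {zero}  tt          = here refl
allForms-complete {suc k} (q , r , γ) =
  ∈-cartesianProduct⁺ (bool∈ q) (∈-cartesianProduct⁺ (allVecs-complete r) (allForms-complete γ))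
  where
  bool∈ : ∀ b → b ∈ false ∷ true ∷ []
  bool∈ false = here refl
  bool∈ true  = there (here refl)

-- Elliptic quadrics of PG(3,2)

IsNondegenerate : QuadForm k → Set
IsNondegenerate γ = ∀ c → (∀ d → polar γ c d ≡ false) → c ≡ 𝟎

HasNoSingularLine : QuadForm k → Set
HasNoSingularLine γ = ∀ c → T (singular γ c) → ∀ d → T (singular γ d) → c ≢ d → ⟦ γ ⟧ (c ⊕ d) ≡ true

HyperplanesMeetingAtMostOnceAreTangent : QuadForm k → Set
HyperplanesMeetingAtMostOnceAreTangent γ = ∀ a → AtMostOne (λ c → T (singular γ c) × dot a c ≡ false) →
  ∃ λ s → T (singular γ s) × (∀ d → dot a d ≡ polar γ s d)

EllipticFacts : QuadForm 4 → Set
EllipticFacts γ = HasNoSingularLine γ → IsNondegenerate γ →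
  # (singular γ) ≡ 5 × HyperplanesMeetingAtMostOnceAreTangent γ

opaque
  unfolding #

  elliptic-facts : ∀ γ → EllipticFacts γ
  elliptic-facts = from-yes (∀-enum? allForms-complete ellipticFacts?)
    where
    noSingularLine? : (γ : QuadForm k) → Dec (HasNoSingularLine γ)
    noSingularLine? γ = ∀ᵛ? λ c → T? (singular γ c) →-dec ∀ᵛ? λ d → T? (singular γ d) →-dec
                                   ¬? (c ≟ᵛ d) →-dec ⟦ γ ⟧ (c ⊕ d) ≟ᵇ true
    nondegenerate? : (γ : QuadForm k) → Dec (IsNondegenerate γ)
    nondegenerate? γ = ∀ᵛ? λ c → ∀ᵛ? (λ d → polar γ c d ≟ᵇ false) →-dec c ≟ᵛ 𝟎
    tangent? : (γ : QuadForm k) → Dec (HyperplanesMeetingAtMostOnceAreTangent γ)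
    tangent? γ = ∀ᵛ? λ a → atMostOne? (λ c → T? (singular γ c) ×-dec dot a c ≟ᵇ false) →-dec
                            ∃ᵛ? λ s → T? (singular γ s) ×-dec ∀ᵛ? λ d → dot a d ≟ᵇ polar γ s d
    ellipticFacts? : (γ : QuadForm 4) → Dec (EllipticFacts γ)
    ellipticFacts? γ = noSingularLine? γ →-dec nondegenerate? γ →-dec
                       # (singular γ) ≟ℕ 5 ×-dec tangent? γ

-- The form Qf and its polar form Bf

swapPairs : V → V
swapPairs (x₀ ∷ x₁ ∷ x₂ ∷ x₃ ∷ x₄ ∷ x₅ ∷ x₆ ∷ x₇ ∷ []) = x₁ ∷ x₀ ∷ x₃ ∷ x₂ ∷ x₅ ∷ x₄ ∷ x₇ ∷ x₆ ∷ []

Bf≡dot-swapPairs : ∀ u v → Bf u v ≡ dot (swapPairs u) v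
Bf≡dot-swapPairs = from-yes (∀ᵛ? λ u → ∀ᵛ? λ v → Bf u v ≟ᵇ dot (swapPairs u) v)

Bf-nondegenerate : ∀ u → (∀ v → Bf u v ≡ false) → u ≡ 𝟎
Bf-nondegenerate = from-yes (∀ᵛ? λ u → ∀ᵛ? (λ v → Bf u v ≟ᵇ false) →-dec u ≟ᵛ 𝟎)

Bf-⊕ʳ : ∀ w u v → Bf w (u ⊕ v) ≡ Bf w u xor Bf w v
Bf-⊕ʳ w u v = begin
  Bf w (u ⊕ v)                                            ≡⟨ Bf≡dot-swapPairs w (u ⊕ v) ⟩
  dot (swapPairs w) (u ⊕ v)                               ≡⟨ dot-⊕ʳ (swapPairs w) u v ⟩
  dot (swapPairs w) u xor dot (swapPairs w) v             ≡⟨ cong₂ _xor_ (Bf≡dot-swapPairs w u) (Bf≡dot-swapPairs w v) ⟨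
  Bf w u xor Bf w v                                       ∎

Bf-𝟎ʳ : ∀ w → Bf w 𝟎 ≡ false
Bf-𝟎ʳ w = trans (Bf≡dot-swapPairs w 𝟎) (dot-𝟎ʳ (swapPairs w))
  where
  dot-𝟎ʳ : (r : Vec Bool k) → dot r 𝟎 ≡ false
  dot-𝟎ʳ [] = refl
  dot-𝟎ʳ (a ∷ r) = dot-𝟎ʳ r

Bf-comm : ∀ u v → Bf u v ≡ Bf v u
Bf-comm u v = begin
  (Qf (u ⊕ v) xor Qf u) xor Qf v   ≡⟨ cong (λ w → (Qf w xor Qf u) xor Qf v) (⊕-comm u v) ⟩
  (Qf (v ⊕ u) xor Qf u) xor Qf v   ≡⟨ xor-right-comm (Qf (v ⊕ u)) (Qf u) (Qf v) ⟩
  (Qf (v ⊕ u) xor Qf v) xor Qf u   ∎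

Bf-⊕ˡ : ∀ u v w → Bf (u ⊕ v) w ≡ Bf u w xor Bf v w
Bf-⊕ˡ u v w = begin
  Bf (u ⊕ v) w          ≡⟨ Bf-comm (u ⊕ v) w ⟩
  Bf w (u ⊕ v)          ≡⟨ Bf-⊕ʳ w u v ⟩
  Bf w u xor Bf w v     ≡⟨ cong₂ _xor_ (Bf-comm w u) (Bf-comm w v) ⟩
  Bf u w xor Bf v w     ∎

Bf-self : ∀ u → Bf u u ≡ false
Bf-self u = begin
  (Qf (u ⊕ u) xor Qf u) xor Qf u   ≡⟨ cong (λ w → (Qf w xor Qf u) xor Qf u) (⊕-self u) ⟩
  Qf u xor Qf u                    ≡⟨ xor-same (Qf u) ⟩
  false                            ∎

Qf-⊕ : ∀ u v → Qf (u ⊕ v) ≡ (Qf u xor Qf v) xor Bf u v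
Qf-⊕ u v = polarisation (Qf (u ⊕ v)) (Qf u) (Qf v)
  where
  open xor-∧-Solver
  polarisation : ∀ x a b → x ≡ (a xor b) xor ((x xor a) xor b)
  polarisation = solve 3 (λ x a b → x := (a :+ b) :+ ((x :+ a) :+ b)) refl

Qf[_] : Vec V k → QuadForm k
Qf[ [] ]     = tt
Qf[ e ∷ es ] = Qf e , map (Bf e) es , Qf[ es ]

Bf-linʳ : ∀ w (es : Vec V k) c → Bf w (lin es c) ≡ dot (map (Bf w) es) c
Bf-linʳ w []       []          = Bf-𝟎ʳ w
Bf-linʳ w (e ∷ es) (false ∷ c) = Bf-linʳ w es c
Bf-linʳ w (e ∷ es) (true ∷ c)  = trans (Bf-⊕ʳ w e (lin es c)) (cong (Bf w e xor_) (Bf-linʳ w es c))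

Qf-lin : (es : Vec V k) (c : Vec Bool k) → Qf (lin es c) ≡ ⟦ Qf[ es ] ⟧ c
Qf-lin []       []          = refl
Qf-lin (e ∷ es) (false ∷ c) = Qf-lin es c
Qf-lin (e ∷ es) (true ∷ c)  = begin
  Qf (e ⊕ lin es c)
    ≡⟨ Qf-⊕ e (lin es c) ⟩
  (Qf e xor Qf (lin es c)) xor Bf e (lin es c)
    ≡⟨ cong₂ (λ x y → (Qf e xor x) xor y) (Qf-lin es c) (Bf-linʳ e es c) ⟩
  (Qf e xor ⟦ Qf[ es ] ⟧ c) xor dot (map (Bf e) es) c
    ≡⟨ xor-right-comm (Qf e) _ _ ⟩
  (Qf e xor dot (map (Bf e) es) c) xor ⟦ Qf[ es ] ⟧ c
    ∎

Bf-lin : (es : Vec V k) (c d : Vec Bool k) → Bf (lin es c) (lin es d) ≡ polar Qf[ es ] c d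
Bf-lin es c d = begin
  (Qf (lin es c ⊕ lin es d) xor Qf (lin es c)) xor Qf (lin es d)
    ≡⟨ cong (λ x → (Qf x xor _) xor _) (lin-⊕ es c d) ⟨
  (Qf (lin es (c ⊕ d)) xor Qf (lin es c)) xor Qf (lin es d)
    ≡⟨ cong₂ _xor_ (cong₂ _xor_ (Qf-lin es (c ⊕ d)) (Qf-lin es c)) (Qf-lin es d) ⟩
  polar Qf[ es ] c d
    ∎

onQ-lin : {es : Vec V k} → Independent es → (c : Vec Bool k) → onQ (lin es c) ≡ singular Qf[ es ] c
onQ-lin {es = es} ind c = cong₂ (λ a b → a ∧ not b) (nonzero-lin ind c) (Qf-lin es c)

T-onQ : {v : V} → T (onQ v) ⇔ (v ≢ 𝟎 × Qf v ≡ false)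
T-onQ = mk⇔ (λ v∈Q → let nz , nQ = to T-∧ v∈Q in to T-nonzero nz , to T-not-≡ nQ)
            (λ (v≢𝟎 , Qv≡false) → from T-∧ (from T-nonzero v≢𝟎 , from T-not-≡ Qv≡false))

T-quadricIn : {S : V → Bool} {v : V} → T (quadricIn S v) ⇔ (T (S v) × v ≢ 𝟎 × Qf v ≡ false)
T-quadricIn {S} {v} = mk⇔ (λ v∈ → let v∈S , v∈Q = to (T-∧ {S v}) v∈ in v∈S , to T-onQ v∈Q)
                          (λ (v∈S , v∈Q) → from T-∧ (v∈S , from T-onQ v∈Q))

Bf-totally-singular : {W : V → Bool} → (∀ v → T (W v) → Qf v ≡ false) → Closed W →
                      ∀ {u v} → T (W u) → T (W v) → Bf u v ≡ false
Bf-totally-singular singular closed {u} {v} u∈W v∈W =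
  cong₂ _xor_ (cong₂ _xor_ (singular _ (closed u v u∈W v∈W)) (singular u u∈W)) (singular v v∈W)

solid-basis : {W : V → Bool} → IsSolid W → Basis W 4
solid-basis {W} ((𝟎∈W , closed) , count≡16) = basis 𝟎∈W closed (trans (sym (count≡# W)) count≡16)

Qf-vanishes-on-line : {u v : V} → Qf u ≡ false → Qf v ≡ false → Qf (u ⊕ v) ≡ false →
                      ∀ x → T (⟨ u ∷ v ∷ [] ⟩ x) → Qf x ≡ false
Qf-vanishes-on-line {u} {v} Qu Qv Q[u⊕v] x x∈ with ∈⟨⟩⇒lin (u ∷ v ∷ []) {x} x∈
... | false ∷ false ∷ [] , refl = refl
... | false ∷ true  ∷ [] , refl = trans (cong Qf (⊕-identityʳ v)) Qv
... | true  ∷ false ∷ [] , refl = trans (cong Qf (⊕-identityʳ u)) Qu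
... | true  ∷ true  ∷ [] , refl = trans (cong (λ w → Qf (u ⊕ w)) (⊕-identityʳ v)) Q[u⊕v]

line-through : {u v : V} → u ≢ 𝟎 → v ≢ 𝟎 → u ≢ v → IsLine ⟨ u ∷ v ∷ [] ⟩
line-through {u} {v} u≢𝟎 v≢𝟎 u≢v =
  (𝟎∈⟨⟩ , ⟨⟩-closed (u ∷ v ∷ [])) , trans (count≡# ⟨ u ∷ v ∷ [] ⟩) (#⟨⟩ independent)
  where
  𝟎∈⟨⟩ : T (⟨ u ∷ v ∷ [] ⟩ 𝟎)
  𝟎∈⟨⟩ = lin∈⟨⟩ (u ∷ v ∷ []) 𝟎
  u∉⟨v⟩ : ¬ T (⟨ v ∷ [] ⟩ u)
  u∉⟨v⟩ u∈ with ∈⟨⟩⇒lin (v ∷ []) u∈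
  ... | false ∷ [] , 𝟎≡u  = u≢𝟎 (sym 𝟎≡u)
  ... | true  ∷ [] , v⊕𝟎≡u = u≢v (trans (sym v⊕𝟎≡u) (⊕-identityʳ v))
  independent : Independent (u ∷ v ∷ [])
  independent = u∉⟨v⟩ , (λ v∈ → v≢𝟎 (to nonzero≡false⇔≡𝟎 (to T-not-≡ v∈))) , tt

-- The elliptic quadric Q⁻(3,2) = quadricIn S

module EllipticSolid {S : V → Bool} (elliptic : IsEllipticSolid S) where

  𝟎∈S : T (S 𝟎)
  𝟎∈S = proj₁ (proj₁ (proj₁ elliptic))

  S-closed : Closed S
  S-closed = proj₂ (proj₁ (proj₁ elliptic))

  S-nondegenerate : ∀ u → T (S u) → (∀ v → T (S v) → Bf u v ≡ false) → u ≡ 𝟎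
  S-nondegenerate = proj₁ (proj₂ elliptic)

  S-has-no-singular-line : ∀ L → IsLine L → (∀ v → T (L v) → T (S v)) → ¬ (∀ v → T (L v) → Qf v ≡ false)
  S-has-no-singular-line = proj₂ (proj₂ elliptic)

  open Basis (solid-basis (proj₁ elliptic)) renaming (vectors to es)

  γ : QuadForm 4
  γ = Qf[ es ]

  lin∈S : ∀ c → T (S (lin es c))
  lin∈S c = span⊆ _ (lin∈⟨⟩ es c)

  coordinates : ∀ {x} → T (S x) → ∃ λ c → lin es c ≡ x
  coordinates {x} x∈S = ∈⟨⟩⇒lin es (⊆span x x∈S)

  singular⇒point : ∀ {c} → T (singular γ c) → T (quadricIn S (lin es c))
  singular⇒point {c} c∈ = from T-∧ (lin∈S c , subst T (sym (onQ-lin independent c)) c∈)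

  secant : ∀ {u v} → T (quadricIn S u) → T (quadricIn S v) → u ≢ v → Qf (u ⊕ v) ≡ true
  secant {u} {v} u∈ v∈ u≢v = decidable-stable (Qf (u ⊕ v) ≟ᵇ true) λ Q[u⊕v]≢true →
    let u∈S , u≢𝟎 , Qu = to (T-quadricIn {S}) u∈
        v∈S , v≢𝟎 , Qv = to (T-quadricIn {S}) v∈
    in S-has-no-singular-line ⟨ u ∷ v ∷ [] ⟩ (line-through u≢𝟎 v≢𝟎 u≢v)
         (⟨⟩⊆ 𝟎∈S S-closed (u∈S ∷ v∈S ∷ [])) (Qf-vanishes-on-line Qu Qv (¬-not Q[u⊕v]≢true))

  γ-hasNoSingularLine : HasNoSingularLine γ
  γ-hasNoSingularLine c c∈ d d∈ c≢d = begin
    ⟦ γ ⟧ (c ⊕ d)               ≡⟨ Qf-lin es (c ⊕ d) ⟨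
    Qf (lin es (c ⊕ d))         ≡⟨ cong Qf (lin-⊕ es c d) ⟩
    Qf (lin es c ⊕ lin es d)    ≡⟨ secant (singular⇒point c∈) (singular⇒point d∈)
                                          (c≢d ∘ lin-injective independent) ⟩
    true                        ∎

  γ-isNondegenerate : IsNondegenerate γ
  γ-isNondegenerate c c⊥ = lin≡𝟎⇒≡𝟎 independent c (S-nondegenerate (lin es c) (lin∈S c) lin-c⊥S)
    where
    lin-c⊥S : ∀ y → T (S y) → Bf (lin es c) y ≡ false
    lin-c⊥S y y∈S = let d , lin-d≡y = coordinates y∈S in
      subst (λ y → Bf (lin es c) y ≡ false) lin-d≡y (trans (Bf-lin es c d) (c⊥ d))

  γ-facts : # (singular γ) ≡ 5 × HyperplanesMeetingAtMostOnceAreTangent γ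
  γ-facts = elliptic-facts γ γ-hasNoSingularLine γ-isNondegenerate

  #points : count (quadricIn S) ≡ 5
  #points = begin
    count (quadricIn S)               ≡⟨ count≡# (quadricIn S) ⟩
    # (λ x → S x ∧ onQ x)             ≡⟨ #-cong (λ x → cong (_∧ onQ x) (S≡⟨es⟩ x)) ⟩
    # (λ x → ⟨ es ⟩ x ∧ onQ x)        ≡⟨ #-⟨⟩∧ independent onQ ⟩
    # (λ c → onQ (lin es c))          ≡⟨ #-cong (onQ-lin independent) ⟩
    # (singular γ)                    ≡⟨ proj₁ γ-facts ⟩
    5                                 ∎
    where
    S≡⟨es⟩ : ∀ x → S x ≡ ⟨ es ⟩ x
    S≡⟨es⟩ x = ⇔→≡ (mk⇔ (to T-≡ ∘ ⊆span x ∘ from T-≡) (to T-≡ ∘ span⊆ x ∘ from T-≡))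

  tangent : ∀ w → AtMostOne (λ P → T (quadricIn S P) × Bf w P ≡ false) →
            ∃ λ s → T (quadricIn S s) × (∀ x → T (S x) → Bf w x ≡ Bf s x)
  tangent w unique = lin es s , singular⇒point s∈ , Bf-w≡Bf-s
    where
    a : Vec Bool 4
    a = map (Bf w) es
    unique-in-coordinates : AtMostOne (λ c → T (singular γ c) × dot a c ≡ false)
    unique-in-coordinates c (c∈ , ac≡false) d (d∈ , ad≡false) = lin-injective independent
      (unique (lin es c) (singular⇒point c∈ , trans (Bf-linʳ w es c) ac≡false)
              (lin es d) (singular⇒point d∈ , trans (Bf-linʳ w es d) ad≡false))
    tangent-point : ∃ λ s → T (singular γ s) × (∀ d → dot a d ≡ polar γ s d)
    tangent-point = proj₂ γ-facts a unique-in-coordinates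
    s : Vec Bool 4
    s = proj₁ tangent-point
    s∈ : T (singular γ s)
    s∈ = proj₁ (proj₂ tangent-point)
    Bf-w≡Bf-s : ∀ x → T (S x) → Bf w x ≡ Bf (lin es s) x
    Bf-w≡Bf-s x x∈S = let d , lin-d≡x = coordinates x∈S in
      subst (λ x → Bf w x ≡ Bf (lin es s) x) lin-d≡x
        (trans (Bf-linʳ w es d) (trans (proj₂ (proj₂ tangent-point) d) (sym (Bf-lin es s d))))

-- The graph

lineCount-two : (p : V → Bool) (u v : V) → T (p u) → T (p v) → p (u ⊕ v) ≡ false → lineCount p u v ≡ 2
lineCount-two p u v pu pv puv rewrite to T-≡ pu | to T-≡ pv | puv = refl

lineCount-two⇒ : (p : V → Bool) (u v : V) → T (p u) → T (p v) → lineCount p u v ≡ 2 → p (u ⊕ v) ≡ false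
lineCount-two⇒ p u v pu pv two rewrite to T-≡ pu | to T-≡ pv with p (u ⊕ v)
... | false = refl
... | true  = contradiction two λ ()

lineCount-one⇒ : (p : V → Bool) (u v : V) → p u ≡ false → p v ≡ false → lineCount p u v ≡ 1 → T (p (u ⊕ v))
lineCount-one⇒ p u v pu pv one rewrite pu | pv with p (u ⊕ v)
... | true  = _
... | false = contradiction one λ ()

secant⇒adjacent : (Π : V → Bool) {u v : V} → T (onQ u) → T (onQ v) → u ≢ v → Qf (u ⊕ v) ≡ true → Adj Π u v
secant⇒adjacent Π {u} {v} u∈Q v∈Q u≢v Q[u⊕v]≡true =
  u≢v , inj₁ (lineCount-two onQ u v u∈Q v∈Q
                (trans (cong (λ b → nonzero (u ⊕ v) ∧ not b) Q[u⊕v]≡true) (∧-zeroʳ _)))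

adjacent⇒Bf∨Π : (Π : V → Bool) {u v : V} → Vertex Π u → Vertex Π v → Adj Π u v →
                Bf u v ≡ true ⊎ T (Π (u ⊕ v))
adjacent⇒Bf∨Π Π {u} {v} (u∈Q , _) (v∈Q , _) (u≢v , inj₁ two) = inj₁ (begin
  (Qf (u ⊕ v) xor Qf u) xor Qf v
    ≡⟨ cong₂ (λ a b → (a xor b) xor Qf v) Q[u⊕v]≡true (proj₂ (to (T-onQ {u}) u∈Q)) ⟩
  true xor Qf v
    ≡⟨ cong (true xor_) (proj₂ (to (T-onQ {v}) v∈Q)) ⟩
  true
    ∎)
  where
  Q[u⊕v]≡true : Qf (u ⊕ v) ≡ true
  Q[u⊕v]≡true = decidable-stable (Qf (u ⊕ v) ≟ᵇ true) λ Q≢true →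
    subst T (lineCount-two⇒ onQ u v u∈Q v∈Q two) (from (T-onQ {u ⊕ v}) (u≢v ∘ ⊕≡𝟎⇒≡ , ¬-not Q≢true))
adjacent⇒Bf∨Π Π {u} {v} (_ , u∉Π) (_ , v∉Π) (_ , inj₂ (_ , one)) =
  inj₂ (proj₁ (to (T-∧ {Π (u ⊕ v)}) (lineCount-one⇒ (λ w → Π w ∧ nonzero w) u v
    (cong (_∧ nonzero u) (to ¬T⇔≡false u∉Π)) (cong (_∧ nonzero v) (to ¬T⇔≡false v∉Π)) one)))

module Maximality {Π S : V → Bool} (generator : IsGenerator Π) (elliptic : IsEllipticSolid S)
                  (disjoint : ∀ v → T (quadricIn S v) → ¬ T (Π v)) where

  open EllipticSolid elliptic

  Π-closed : Closed Π
  Π-closed = proj₂ (proj₁ (proj₁ generator))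

  Π-singular : ∀ v → T (Π v) → Qf v ≡ false
  Π-singular = proj₂ generator

  point⇒vertex : ∀ v → T (quadricIn S v) → Vertex Π v
  point⇒vertex v v∈ = proj₂ (to (T-∧ {S v}) v∈) , disjoint v v∈

  Π∩S≡𝟎 : ∀ x → T (Π x) → T (S x) → x ≡ 𝟎
  Π∩S≡𝟎 x x∈Π x∈S = decidable-stable (x ≟ᵛ 𝟎) λ x≢𝟎 →
    disjoint x (from (T-quadricIn {S}) (x∈S , x≢𝟎 , Π-singular x x∈Π)) x∈Π

  Π⊥S⇒≡𝟎 : ∀ π → T (Π π) → (∀ x → T (S x) → Bf π x ≡ false) → π ≡ 𝟎
  Π⊥S⇒≡𝟎 π π∈Π π⊥S = Bf-nondegenerate π π⊥V
    where
    π⊥V : ∀ y → Bf π y ≡ false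
    π⊥V y =
      let y₁ , y₂ , y₁∈Π , y₂∈S , y≡y₁⊕y₂ =
            ⊕-decomposition (solid-basis (proj₁ generator)) (solid-basis (proj₁ elliptic)) Π∩S≡𝟎 y
      in begin
        Bf π y                  ≡⟨ cong (Bf π) y≡y₁⊕y₂ ⟩
        Bf π (y₁ ⊕ y₂)          ≡⟨ Bf-⊕ʳ π y₁ y₂ ⟩
        Bf π y₁ xor Bf π y₂     ≡⟨ cong₂ _xor_ (Bf-totally-singular Π-singular Π-closed π∈Π y₁∈Π)
                                               (π⊥S y₂ y₂∈S) ⟩
        false                   ∎

  Π-neighbour-unique : ∀ w → AtMostOne (λ P → T (quadricIn S P) × T (Π (w ⊕ P)))
  Π-neighbour-unique w P (P∈ , w⊕P∈Π) P′ (P′∈ , w⊕P′∈Π) = decidable-stable (P ≟ᵛ P′) λ P≢P′ →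
    contradiction (trans (sym (Π-singular (P ⊕ P′) P⊕P′∈Π)) (secant P∈ P′∈ P≢P′)) λ ()
    where
    P⊕P′∈Π : T (Π (P ⊕ P′))
    P⊕P′∈Π = subst (T ∘ Π) (begin
      (w ⊕ P) ⊕ (w ⊕ P′)   ≡⟨ ⊕-interchange w P w P′ ⟩
      (w ⊕ w) ⊕ (P ⊕ P′)   ≡⟨ cong (_⊕ (P ⊕ P′)) (⊕-self w) ⟩
      𝟎 ⊕ (P ⊕ P′)         ≡⟨ ⊕-identityˡ (P ⊕ P′) ⟩
      P ⊕ P′               ∎) (Π-closed _ _ w⊕P∈Π w⊕P′∈Π)

  non-secant⇒Π : ∀ {w P} → Vertex Π w → T (quadricIn S P) → Adj Π w P → Bf w P ≡ false → T (Π (w ⊕ P))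
  non-secant⇒Π {P = P} w-vertex P∈ w~P Bf≡false with adjacent⇒Bf∨Π Π w-vertex (point⇒vertex P P∈) w~P
  ... | inj₁ Bf≡true = contradiction (trans (sym Bf≡false) Bf≡true) λ ()
  ... | inj₂ w⊕P∈Π  = w⊕P∈Π

  adjacent-to-all⇒∈ : ∀ w → Vertex Π w → (∀ P → T (quadricIn S P) → w ≢ P → Adj Π w P) → T (quadricIn S w)
  adjacent-to-all⇒∈ w w-vertex adjacent = decidable-stable (T? (quadricIn S w)) ¬w∉
    where
    ¬w∉ : ¬ ¬ T (quadricIn S w)
    ¬w∉ w∉ = w∉ (subst (T ∘ quadricIn S) (sym w≡s) s∈)
      where
      Bf≡false⇒Π : ∀ {P} → T (quadricIn S P) → Bf w P ≡ false → T (Π (w ⊕ P))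
      Bf≡false⇒Π {P} P∈ = non-secant⇒Π w-vertex P∈ (adjacent P P∈ λ { refl → w∉ P∈ })
      tangent-point : ∃ λ s → T (quadricIn S s) × (∀ x → T (S x) → Bf w x ≡ Bf s x)
      tangent-point = tangent w λ P (P∈ , wP≡false) P′ (P′∈ , wP′≡false) →
        Π-neighbour-unique w P (P∈ , Bf≡false⇒Π P∈ wP≡false) P′ (P′∈ , Bf≡false⇒Π P′∈ wP′≡false)
      s : V
      s = proj₁ tangent-point
      s∈ : T (quadricIn S s)
      s∈ = proj₁ (proj₂ tangent-point)
      Bf-w≡Bf-s : ∀ x → T (S x) → Bf w x ≡ Bf s x
      Bf-w≡Bf-s = proj₂ (proj₂ tangent-point)
      w⊕s∈Π : T (Π (w ⊕ s))
      w⊕s∈Π = Bf≡false⇒Π s∈ (trans (Bf-w≡Bf-s s (proj₁ (to (T-∧ {S s}) s∈))) (Bf-self s))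
      w⊕s⊥S : ∀ x → T (S x) → Bf (w ⊕ s) x ≡ false
      w⊕s⊥S x x∈S = begin
        Bf (w ⊕ s) x         ≡⟨ Bf-⊕ˡ w s x ⟩
        Bf w x xor Bf s x    ≡⟨ cong (_xor Bf s x) (Bf-w≡Bf-s x x∈S) ⟩
        Bf s x xor Bf s x    ≡⟨ xor-same (Bf s x) ⟩
        false                ∎
      w≡s : w ≡ s
      w≡s = ⊕≡𝟎⇒≡ (Π⊥S⇒≡𝟎 (w ⊕ s) w⊕s∈Π w⊕s⊥S)

lemma4p8 : (Π : V → Bool) → IsGenerator Π →
    (S : V → Bool) → IsEllipticSolid S →
    (∀ v → T (quadricIn S v) → ¬ T (Π v)) →
    IsMaximalClique Π (quadricIn S) × count (quadricIn S) ≡ 5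
lemma4p8 Π generator S elliptic disjoint = ((point⇒vertex , adjacent) , maximal) , #points
  where
  open EllipticSolid elliptic
  open Maximality generator elliptic disjoint
  adjacent : ∀ u v → T (quadricIn S u) → T (quadricIn S v) → u ≢ v → Adj Π u v
  adjacent u v u∈ v∈ u≢v =
    secant⇒adjacent Π (proj₁ (point⇒vertex u u∈)) (proj₁ (point⇒vertex v v∈)) u≢v (secant u∈ v∈ u≢v)
  maximal : ∀ C′ → IsClique Π C′ → (∀ v → T (quadricIn S v) → T (C′ v)) → ∀ w → T (C′ w) → T (quadricIn S w)
  maximal C′ (C′-vertices , C′-adjacent) Q⊆C′ w w∈C′ =
    adjacent-to-all⇒∈ w (C′-vertices w w∈C′) λ P P∈ w≢P → C′-adjacent w P w∈C′ (Q⊆C′ P P∈) w≢P
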